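{- Let $\mathcal{W}$, $\mathbf{D}$, $\cdot$ and $\theta$ be as in the context, and let $\mathcal{I}=(X,(P_x),(R_{xy}))$ be a standard $(2,3)$-instance of $\mathrm{CSP}(\mathbf{D})$. Suppose $\varphi$ and $\psi$ are solutions of the quotient instance $\mathcal{I}/\theta$ with $\varphi\longrightarrow\psi$. If $\mathcal{I}$ has a solution passing through $\varphi$, then $\mathcal{I}$ has a solution passing through $\psi$.
   Context: Setting: $\mathcal{W}$ is a tractable variety, $\mathbf{D}$ a finite algebra of the same type with a binary term $\cdot$ and a congruence $\theta$ such that $\cdot$ is a $2$-semilattice operation on $\mathbf{D}/\theta$ (i.e. satisfies $x\cdot x\approx x$, $x\cdot y\approx y\cdot x$, $x\cdot(x\cdot y)\approx x\cdot y$), each $\theta$-class as a subalgebra is in $\mathcal{W}$, $\mathcal{W}\models x\cdot y\approx x$, and $\mathbf{D}\models x\cdot(y\cdot z)\approx x\cdot(z\cdot y)$. For a subalgebra $\mathbf{A}$ of $\mathbf{D}$ or $\mathbf{D}^2$ let $\theta_{\mathbf{A}}=\{(a,b)\in A^2:a\cdot b=a,\ b\cdot a=b\}$ (a congruence of $\mathbf{A}$). A standard $(2,3)$-instance of $\mathrm{CSP}(\mathbf{D})$ is $(X,(P_x),(R_{xy}))$ with $X$ finite, $P_x\le\mathbf{D}$, $R_{xy}\le\mathbf{D}^2$, $R_{xy}\subseteq P_x\times P_y$, satisfying (P1) $R_{xx}=\{(a,a):a\in P_x\}$; (P2) for all $x,y,z$ and $(a,b)\in R_{xy}$ some $c\in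 P_z$ has $(a,c)\in R_{xz}$, $(b,c)\in R_{yz}$; (P3) $R_{xy}$ subdirect in $\mathbf{P}_x\times\mathbf{P}_y$ when nonempty; (P4) $R_{yx}=R_{xy}^{ -1}$. A solution of $\mathcal{I}$ is a map $s$ with $s(x)\in P_x$ and $(s(x),s(y))\in R_{xy}$ for all $x,y$. The quotient instance $\mathcal{I}/\theta$ has potatoes $P_x/\theta_{\mathbf{P}_x}$ and relations $R_{xy}^{\theta}=\{(a/\theta_{\mathbf{P}_x},b/\theta_{\mathbf{P}_y}):(a,b)\in R_{xy}\}$; its solutions are maps $\varphi$ with $\varphi(x)\in P_x/\theta_{\mathbf{P}_x}$ and $(\varphi(x),\varphi(y))\in R^\theta_{xy}$. For solutions $\varphi,\psi$ of $\mathcal{I}/\theta$, $\varphi\longrightarrow\psi$ means $\varphi(x)\cdot\psi(x)=\psi(x)$ in $\mathbf{P}_x/\theta_{\mathbf{P}_x}$ for all $x$. A solution $s$ of $\mathcal{I}$ passes through $\varphi$ if $s(x)/\theta_{\mathbf{P}_x}=\varphi(x)$ for all $x$. -}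

module Defs where

open import Data.Nat using (ℕ)
open import Data.Fin using (Fin; zero; suc)
open import Data.Bool using (Bool; T)
open import Data.Product using (Σ; _×_; _,_; ∃; ∃₂)
open import Relation.Binary.PropositionalEquality using (_≡_)

record Signature : Set₁ where
  field
    Op    : Set
    arity : Op → ℕ
open Signature public

record Algebra (σ : Signature) : Set₁ where
  field
    Carrier : Set
    op      : (f : Op σ) → (Fin (arity σ f) → Carrier) → Carrier
open Algebra public

record FinAlgebra (σ : Signature) : Set where
  field
    size : ℕ
    fop  : (f : Op σ) → (Fin (arity σ f) → Fin size) → Fin size
open FinAlgebra public

toAlgebra : ∀ {σ} → FinAlgebra σ → Algebra σ
toAlgebra D = record { Carrier = Fin (size D) ; op = fop D }

data Term (σ : Signature) (V : Set) : Set where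
  var : V → Term σ V
  app : (f : Op σ) → (Fin (arity σ f) → Term σ V) → Term σ V

eval : ∀ {σ V} (A : Algebra σ) → (V → Carrier A) → Term σ V → Carrier A
eval A ρ (var v)    = ρ v
eval A ρ (app f ts) = op A f (λ i → eval A ρ (ts i))

record Identity (σ : Signature) : Set where
  field
    nvars : ℕ
    lhs   : Term σ (Fin nvars)
    rhs   : Term σ (Fin nvars)
open Identity public

Satisfies : ∀ {σ} → Algebra σ → Identity σ → Set
Satisfies A e = (ρ : Fin (nvars e) → Carrier A) → eval A ρ (lhs e) ≡ eval A ρ (rhs e)

-- The subalgebra of A with universe B (assumed closed) satisfies e:
-- term operations of a subalgebra are the restrictions of those of A.
SatisfiesOn : ∀ {σ} (A : Algebra σ) → (Carrier A → Set) → Identity σ → Set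
SatisfiesOn A B e =
  (ρ : Fin (nvars e) → Carrier A) → ((i : Fin (nvars e)) → B (ρ i)) →
  eval A ρ (lhs e) ≡ eval A ρ (rhs e)

-- A variety, given (Birkhoff) as the class of models of a set of identities.
record Variety (σ : Signature) : Set₁ where
  field
    Axioms : Identity σ → Set
open Variety public

_∈V_ : ∀ {σ} → Algebra σ → Variety σ → Set
A ∈V W = (e : Identity _) → Axioms W e → Satisfies A e

_⊨_ : ∀ {σ} → Variety σ → Identity σ → Set₁
W ⊨ e = (A : Algebra _) → A ∈V W → Satisfies A e

x₀ x₁ : Fin 2
x₀ = zero
x₁ = suc zero

env₂ : {X : Set} → X → X → Fin 2 → X
env₂ a b zero       = a
env₂ a b (suc zero) = b

dot : ∀ {σ} (D : FinAlgebra σ) → Term σ (Fin 2) → Fin (size D) → Fin (size D) → Fin (size D)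
dot D t a b = eval (toAlgebra D) (env₂ a b) t

dotLeftId : ∀ {σ} → Term σ (Fin 2) → Identity σ
dotLeftId t = record { nvars = 2 ; lhs = t ; rhs = var x₀ }

Subuniverse : ∀ {σ : Signature} (D : FinAlgebra σ) → (Fin (size D) → Bool) → Set
Subuniverse {σ} D P =
  (f : Op σ) (as : Fin (arity σ f) → Fin (size D)) →
  ((i : Fin (arity σ f)) → T (P (as i))) → T (P (fop D f as))

Subuniverse² : ∀ {σ : Signature} (D : FinAlgebra σ) → (Fin (size D) → Fin (size D) → Bool) → Set
Subuniverse² {σ} D R =
  (f : Op σ) (as bs : Fin (arity σ f) → Fin (size D)) →
  ((i : Fin (arity σ f)) → T (R (as i) (bs i))) → T (R (fop D f as) (fop D f bs))

record IsCongruence {σ} (D : FinAlgebra σ) (θ : Fin (size D) → Fin (size D) → Bool) : Set where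
  field
    refl′  : ∀ a → T (θ a a)
    sym′   : ∀ a b → T (θ a b) → T (θ b a)
    trans′ : ∀ a b c → T (θ a b) → T (θ b c) → T (θ a c)
    compat : (f : Op σ) (as bs : Fin (arity σ f) → Fin (size D)) →
             ((i : Fin (arity σ f)) → T (θ (as i) (bs i))) →
             T (θ (fop D f as) (fop D f bs))

record Setting {σ} (W : Variety σ) (D : FinAlgebra σ) (t : Term σ (Fin 2))
               (θ : Fin (size D) → Fin (size D) → Bool) : Set₁ where
  _·_ : Fin (size D) → Fin (size D) → Fin (size D)
  _·_ = dot D t
  field
    θ-congruence : IsCongruence D θ
    -- · is a 2-semilattice operation on D/θ
    idem-θ  : ∀ a → T (θ (a · a) a)
    comm-θ  : ∀ a b → T (θ (a · b) (b · a))
    absorb-θ : ∀ a b → T (θ (a · (a · b)) (a · b))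
    class-sub : ∀ c → Subuniverse D (λ d → θ d c)
    class-in-W : ∀ c (e : Identity σ) → Axioms W e →
                 SatisfiesOn (toAlgebra D) (λ d → T (θ d c)) e
    W-left : W ⊨ dotLeftId t
    D-swap : ∀ a b c → a · (b · c) ≡ a · (c · b)

θ[_] : ∀ {σ} {D : FinAlgebra σ} → Term σ (Fin 2) → (Fin (size D) → Bool) →
       Fin (size D) → Fin (size D) → Set
θ[_] {D = D} t A a b = T (A a) × T (A b) × (dot D t a b ≡ a) × (dot D t b a ≡ b)

record Instance {σ} (D : FinAlgebra σ) (m : ℕ) : Set where
  field
    P : Fin m → Fin (size D) → Bool
    R : Fin m → Fin m → Fin (size D) → Fin (size D) → Bool
open Instance public

record Standard23 {σ} (D : FinAlgebra σ) {m : ℕ} (I : Instance D m) : Set where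
  field
    P-sub : ∀ x → Subuniverse D (P I x)
    R-sub : ∀ x y → Subuniverse² D (R I x y)
    R⊆P×P : ∀ x y a b → T (R I x y a b) → T (P I x a) × T (P I y b)
    P1 : ∀ x a b → (T (R I x x a b) → (a ≡ b × T (P I x a)))
                 × ((a ≡ b × T (P I x a)) → T (R I x x a b))
    P2 : ∀ x y z a b → T (R I x y a b) →
         Σ (Fin (size D)) λ c → T (P I z c) × T (R I x z a c) × T (R I y z b c)
    P3 : ∀ x y → (Σ (Fin (size D)) λ a → Σ (Fin (size D)) λ b → T (R I x y a b)) →
         (∀ a → T (P I x a) → Σ (Fin (size D)) λ b → T (R I x y a b))
         × (∀ b → T (P I y b) → Σ (Fin (size D)) λ a → T (R I x y a b))
    P4 : ∀ x y a b → (T (R I y x b a) → T (R I x y a b)) × (T (R I x y a b) → T (R I y x b a))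

IsSolution : ∀ {σ} {D : FinAlgebra σ} {m} → Instance D m → (Fin m → Fin (size D)) → Set
IsSolution I s = (∀ x → T (P I x (s x))) × (∀ x y → T (R I x y (s x) (s y)))

-- Solutions of I/θ, represented by a choice of representatives φ x ∈ P_x
-- of the θ_{P_x}-classes.
IsQuotSolution : ∀ {σ} {D : FinAlgebra σ} {m} → Term σ (Fin 2) → Instance D m →
                 (Fin m → Fin (size D)) → Set
IsQuotSolution {D = D} t I φ =
  (∀ x → T (P I x (φ x))) ×
  (∀ x y → Σ (Fin (size D)) λ a → Σ (Fin (size D)) λ b →
     T (R I x y a b) × θ[_] {D = D} t (P I x) a (φ x) × θ[_] {D = D} t (P I y) b (φ y))

Arrow : ∀ {σ} {D : FinAlgebra σ} {m} → Term σ (Fin 2) → Instance D m →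
        (Fin m → Fin (size D)) → (Fin m → Fin (size D)) → Set
Arrow {D = D} t I φ ψ = ∀ x → θ[_] {D = D} t (P I x) (dot D t (φ x) (ψ x)) (ψ x)

PassesThrough : ∀ {σ} {D : FinAlgebra σ} {m} → Term σ (Fin 2) → Instance D m →
                (Fin m → Fin (size D)) → (Fin m → Fin (size D)) → Set
PassesThrough {D = D} t I s φ = ∀ x → θ[_] {D = D} t (P I x) (s x) (φ x)

{-# OPTIONS --safe #-}
-- The solution through ψ is s · ψ, i.e. x ↦ s(x) · ψ(x).  It satisfies every
-- constraint R_xy: multiply (s(x), s(y)) ∈ R_xy by a pair (a, b) ∈ R_xy of
-- representatives of (ψ(x), ψ(y)), and note that u · a = u · ψ(x) whenever
-- a θ_{P_x} ψ(x), because D ⊨ x · (y · z) ≈ x · (z · y).  It passes through ψ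
-- because s(x) · ψ(x) θ φ(x) · ψ(x) θ ψ(x), and inside a potato θ-related
-- elements are θ_{P_x}-related: P_x ∩ c/θ is a subalgebra lying in W, where
-- x · y ≈ x holds.
module Submission where

open import Defs
open import Data.Nat using (ℕ)
open import Data.Fin using (Fin; zero; suc)
open import Data.Bool using (Bool; T)
open import Data.Bool.Properties using (T-irrelevant)
open import Data.Product using (Σ; _×_; _,_; proj₁; proj₂)
open import Function using (_∘_)
open import Relation.Nullary.Irrelevant using (Irrelevant)
open import Relation.Binary.PropositionalEquality

OpsExtensionalOn : ∀ {σ} (D : FinAlgebra σ) → (Fin (size D) → Set) → Set
OpsExtensionalOn {σ} D B =
  (f : Op σ) (as bs : Fin (arity σ f) → Fin (size D)) →
  (∀ i → B (as i)) → (∀ i → as i ≡ bs i) → fop D f as ≡ fop D f bs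

env₂-related : ∀ {X Y : Set} (R : X → Y → Set) {a c : X} {b d : Y} →
               R a b → R c d → ∀ v → R (env₂ a c v) (env₂ b d v)
env₂-related R aRb cRd zero       = aRb
env₂-related R aRb cRd (suc zero) = cRd

module _ {σ : Signature} {D : FinAlgebra σ} {R : Fin (size D) → Fin (size D) → Bool}
         (R-sub : Subuniverse² D R) where

  eval-compatible : ∀ {V} {ρ ρ′ : V → Fin (size D)} → (∀ v → T (R (ρ v) (ρ′ v))) →
                    ∀ u → T (R (eval (toAlgebra D) ρ u) (eval (toAlgebra D) ρ′ u))
  eval-compatible ρRρ′ (var v)    = ρRρ′ v
  eval-compatible ρRρ′ (app f ts) = R-sub f _ _ (λ i → eval-compatible ρRρ′ (ts i))

  dot-compatible : (t : Term σ (Fin 2)) {a b c d : Fin (size D)} →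
                   T (R a b) → T (R c d) → T (R (dot D t a c) (dot D t b d))
  dot-compatible t aRb cRd = eval-compatible (env₂-related (λ u v → T (R u v)) aRb cRd) t

module Subalgebra {σ : Signature} (D : FinAlgebra σ) (B : Fin (size D) → Set)
    (B-irrelevant : ∀ {d} → Irrelevant (B d))
    (B-closed : ∀ f as → (∀ i → B (as i)) → B (fop D f as))
    (B-extensional : OpsExtensionalOn D B) where

  algebra : Algebra σ
  algebra = record
    { Carrier = Σ (Fin (size D)) B
    ; op      = λ f as → fop D f (proj₁ ∘ as) , B-closed f (proj₁ ∘ as) (proj₂ ∘ as)
    }

  proj₁-eval : ∀ {V} (ρ : V → Σ (Fin (size D)) B) (ρ′ : V → Fin (size D)) →
               (∀ v → proj₁ (ρ v) ≡ ρ′ v) →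
               ∀ u → proj₁ (eval algebra ρ u) ≡ eval (toAlgebra D) ρ′ u
  proj₁-eval ρ ρ′ ρ≗ρ′ (var v)    = ρ≗ρ′ v
  proj₁-eval ρ ρ′ ρ≗ρ′ (app f ts) =
    B-extensional f _ _ (λ i → proj₂ (eval algebra ρ (ts i)))
                        (λ i → proj₁-eval ρ ρ′ ρ≗ρ′ (ts i))

  satisfies : ∀ e → SatisfiesOn (toAlgebra D) B e → Satisfies algebra e
  satisfies e B⊨e ρ = Σ-≡-by-proj₁ (begin
      proj₁ (eval algebra ρ (lhs e))      ≡⟨ proj₁-eval ρ (proj₁ ∘ ρ) (λ _ → refl) (lhs e) ⟩
      eval (toAlgebra D) (proj₁ ∘ ρ) (lhs e) ≡⟨ B⊨e (proj₁ ∘ ρ) (proj₂ ∘ ρ) ⟩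
      eval (toAlgebra D) (proj₁ ∘ ρ) (rhs e) ≡⟨ proj₁-eval ρ (proj₁ ∘ ρ) (λ _ → refl) (rhs e) ⟨
      proj₁ (eval algebra ρ (rhs e))      ∎)
    where
      open ≡-Reasoning
      Σ-≡-by-proj₁ : {p q : Σ (Fin (size D)) B} → proj₁ p ≡ proj₁ q → p ≡ q
      Σ-≡-by-proj₁ {a , a∈B} {.a , a∈B′} refl = cong (a ,_) (B-irrelevant a∈B a∈B′)

-- Without function extensionality fop D f need not respect pointwise equality
-- of its arguments; on a potato it does, because by (P1) the subuniverse R_xx
-- of D² is the diagonal of P_x.
ops-extensional-on-potato : ∀ {σ} {D : FinAlgebra σ} {m} {I : Instance D m} →
                            Standard23 D I → ∀ x → OpsExtensionalOn D (T ∘ P I x)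
ops-extensional-on-potato std x f as bs as∈P as≗bs =
  proj₁ (proj₁ (P1 x _ _) (R-sub x x f as bs (λ i → proj₂ (P1 x _ _) (as≗bs i , as∈P i))))
  where open Standard23 std

module SettingProperties {σ} {W : Variety σ} {D : FinAlgebra σ} {t : Term σ (Fin 2)}
    {θ : Fin (size D) → Fin (size D) → Bool} (S : Setting W D t θ) where

  open Setting S
  open IsCongruence θ-congruence

  θ⟨_⟩ : (Fin (size D) → Bool) → Fin (size D) → Fin (size D) → Set
  θ⟨_⟩ = θ[_] {D = D} t

  θ⟨⟩⇒θ : ∀ {A a b} → θ⟨ A ⟩ a b → T (θ a b)
  θ⟨⟩⇒θ {a = a} {b} (_ , _ , a·b≡a , b·a≡b) =
    subst₂ (λ u v → T (θ u v)) a·b≡a b·a≡b (comm-θ a b)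

  θ⟨⟩⇒·-congˡ : ∀ {A} u {a b} → θ⟨ A ⟩ a b → u · a ≡ u · b
  θ⟨⟩⇒·-congˡ u {a} {b} (_ , _ , a·b≡a , b·a≡b) = begin
    u · a       ≡⟨ cong (u ·_) a·b≡a ⟨
    u · (a · b) ≡⟨ D-swap u a b ⟩
    u · (b · a) ≡⟨ cong (u ·_) b·a≡b ⟩
    u · b       ∎
    where open ≡-Reasoning

  module _ {B : Fin (size D) → Bool} (B-sub : Subuniverse D B)
           (B-extensional : OpsExtensionalOn D (T ∘ B)) where

    θ⇒·≡ˡ : ∀ {a b} → T (B a) → T (B b) → T (θ a b) → a · b ≡ a
    θ⇒·≡ˡ {a} {b} a∈B b∈B aθb = begin
      a · b                    ≡⟨ proj₁-eval ρ (env₂ a b) ρ≗env₂ t ⟨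
      proj₁ (eval algebra ρ t) ≡⟨ cong proj₁ (W-left algebra algebra∈W ρ) ⟩
      a                        ∎
      where
        open ≡-Reasoning
        open Subalgebra D (λ d → T (B d) × T (θ d b))
          (λ (p , q) (p′ , q′) → cong₂ _,_ (T-irrelevant p p′) (T-irrelevant q q′))
          (λ f as h → B-sub f as (proj₁ ∘ h) , class-sub b f as (proj₂ ∘ h))
          (λ f as bs h → B-extensional f as bs (proj₁ ∘ h))
        ρ : Fin 2 → Σ (Fin (size D)) (λ d → T (B d) × T (θ d b))
        ρ = env₂ (a , a∈B , aθb) (b , b∈B , refl′ b)
        ρ≗env₂ : ∀ v → proj₁ (ρ v) ≡ env₂ a b v
        ρ≗env₂ = env₂-related (λ p d → proj₁ p ≡ d) refl refl
        algebra∈W : algebra ∈V W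
        algebra∈W e ax = satisfies e (λ ρ h → class-in-W b e ax ρ (proj₂ ∘ h))

    θ⇒θ⟨⟩ : ∀ {a b} → T (B a) → T (B b) → T (θ a b) → θ⟨ B ⟩ a b
    θ⇒θ⟨⟩ a∈B b∈B aθb =
      a∈B , b∈B , θ⇒·≡ˡ a∈B b∈B aθb , θ⇒·≡ˡ b∈B a∈B (sym′ _ _ aθb)

module _ {σ} {W : Variety σ} {D : FinAlgebra σ} {t : Term σ (Fin 2)}
    {θ : Fin (size D) → Fin (size D) → Bool} (S : Setting W D t θ)
    {m} {I : Instance D m} (std : Standard23 D I) where

  open Setting S
  open IsCongruence θ-congruence
  open Standard23 std
  open SettingProperties S

  ·-solution : ∀ {s ψ} → IsSolution I s → IsQuotSolution t I ψ →
               IsSolution I (λ x → s x · ψ x)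
  ·-solution {s} {ψ} (_ , s-R) (_ , ψ-reps) = s·ψ∈P , s·ψ-R
    where
      s·ψ-R : ∀ x y → T (R I x y (s x · ψ x) (s y · ψ y))
      s·ψ-R x y =
        let a , b , aRb , aθψx , bθψy = ψ-reps x y
        in subst₂ (λ u v → T (R I x y u v))
                  (θ⟨⟩⇒·-congˡ {P I x} (s x) aθψx) (θ⟨⟩⇒·-congˡ {P I y} (s y) bθψy)
                  (dot-compatible {R = R I x y} (R-sub x y) t (s-R x y) aRb)
      s·ψ∈P : ∀ x → T (P I x (s x · ψ x))
      s·ψ∈P x = proj₁ (R⊆P×P x x _ _ (s·ψ-R x x))

  ·-passes-through : ∀ {s φ ψ} → (∀ x → T (P I x (s x · ψ x))) → (∀ x → T (P I x (ψ x))) →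
                     PassesThrough t I s φ → Arrow t I φ ψ →
                     PassesThrough t I (λ x → s x · ψ x) ψ
  ·-passes-through {ψ = ψ} s·ψ∈P ψ∈P s-through-φ φ⟶ψ x =
    θ⇒θ⟨⟩ {P I x} (P-sub x) (ops-extensional-on-potato std x) (s·ψ∈P x) (ψ∈P x)
      (trans′ _ _ _
        (dot-compatible {R = θ} compat t (θ⟨⟩⇒θ {P I x} (s-through-φ x)) (refl′ (ψ x)))
        (θ⟨⟩⇒θ {P I x} (φ⟶ψ x)))

lemma7p4 : {σ : Signature} (W : Variety σ) (D : FinAlgebra σ) (t : Term σ (Fin 2))
           (θ : Fin (size D) → Fin (size D) → Bool) → Setting W D t θ →
           (m : ℕ) (I : Instance D m) → Standard23 D I →
           (φ ψ : Fin m → Fin (size D)) →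
           IsQuotSolution t I φ → IsQuotSolution t I ψ → Arrow t I φ ψ →
           Σ (Fin m → Fin (size D)) (λ s → IsSolution I s × PassesThrough t I s φ) →
           Σ (Fin m → Fin (size D)) (λ s → IsSolution I s × PassesThrough t I s ψ)
lemma7p4 W D t θ S m I std φ ψ _ ψ-quot φ⟶ψ (s , s-sol , s-through-φ) =
  (λ x → dot D t (s x) (ψ x)) , s·ψ-sol ,
  ·-passes-through S std (proj₁ s·ψ-sol) (proj₁ ψ-quot) s-through-φ φ⟶ψ
  where
    s·ψ-sol : IsSolution I (λ x → dot D t (s x) (ψ x))
    s·ψ-sol = ·-solution S std s-sol ψ-quot
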